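{- Let $\mathbf R=(R;\cdot,',0,1)$ be an effect groupoid. Then $\mathbb R(\mathbb E(\mathbf R))=\mathbf R$.
   Context: An effect groupoid is an algebra $(R;\cdot,',0,1)$ of type $(2,1,0,0)$ such that for all $x,y,z\in R$: (NG0) $1$ is a two-sided unit for $\cdot$; (NG1) $x=x''$; (NG2) $x\cdot 0=0\cdot x=0$; (NG3) $0'=1$; (NG4) $x\cdot(y\cdot x')=0=(y\cdot x')\cdot x$; (NG5) $x\cdot y=y\cdot[(y'\cdot x')'\cdot x']'$; (NG6) $x\cdot(y'\cdot x)'=(y'\cdot x)'\cdot x=(x'\cdot y)'\cdot y$; (NG7) $[(x\cdot y')'\cdot y']'\cdot z=[((x\cdot z)\cdot(y\cdot z)')'\cdot(y\cdot z)']'$; (NG8) if $x'\cdot y'=0$ and $(x\cdot y)'\cdot z'=0$ then $y'\cdot z'=0$, $x'\cdot(y\cdot z)'=0$ and $(x\cdot y)\cdot z=x\cdot(y\cdot z)$. $\mathbb E(\mathbf R)=(R;\oplus,',0,1)$ where $x\oplus y:=(x'\cdot y')'$, defined exactly when $x\cdot y=0$; this is a lattice effect algebra (an effect algebra, in the sense of Foulis–Bennett, whose induced order $a\leq b\iff \exists c:\ a\oplus c=b$ is a lattice order, with meet $\wedge$). For a lattice effect algebra $\mathbf E$, $\mathbb R(\mathbf E)=(E;\cdot,',0,1)$ with $x\cdot y:=((x'\wedge y)\oplus y')'$. -}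

module Defs where

open import Level using (Level; suc; _⊔_)
open import Relation.Binary.PropositionalEquality using (_≡_)
open import Data.Product using (Σ; _×_; ∃)

record EffectGroupoid (a : Level) : Set (suc a) where
  infixl 7 _·_
  infix 8 _′
  field
    R   : Set a
    _·_ : R → R → R
    _′  : R → R
    𝟎   : R
    𝟏   : R
    ·-identityˡ : ∀ x → 𝟏 · x ≡ x
    ·-identityʳ : ∀ x → x · 𝟏 ≡ x
    NG1 : ∀ x → x ≡ (x ′) ′
    NG2ʳ : ∀ x → x · 𝟎 ≡ 𝟎
    NG2ˡ : ∀ x → 𝟎 · x ≡ 𝟎
    NG3 : 𝟎 ′ ≡ 𝟏
    NG4ˡ : ∀ x y → x · (y · x ′) ≡ 𝟎
    NG4ʳ : ∀ x y → (y · x ′) · x ≡ 𝟎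
    NG5 : ∀ x y → x · y ≡ y · (((y ′ · x ′) ′ · x ′) ′)
    NG6a : ∀ x y → x · ((y ′ · x) ′) ≡ (y ′ · x) ′ · x
    NG6b : ∀ x y → (y ′ · x) ′ · x ≡ (x ′ · y) ′ · y
    NG7 : ∀ x y z →
      ((x · y ′) ′ · y ′) ′ · z ≡ (((x · z) · (y · z) ′) ′ · (y · z) ′) ′
    NG8 : ∀ x y z → x ′ · y ′ ≡ 𝟎 → (x · y) ′ · z ′ ≡ 𝟎 →
      (y ′ · z ′ ≡ 𝟎) × (x ′ · (y · z) ′ ≡ 𝟎) × ((x · y) · z ≡ x · (y · z))

module EffectAlgebraOf {a : Level} (G : EffectGroupoid a) where
  open EffectGroupoid G

  _⊕-defined_ : R → R → Set a
  x ⊕-defined y = x · y ≡ 𝟎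

  -- its value (only meaningful when x ⊕-defined y)
  _⊕_ : R → R → R
  x ⊕ y = ((x ′) · (y ′)) ′

  _≤ₑ_ : R → R → Set a
  p ≤ₑ q = ∃ λ c → (p ⊕-defined c) × (p ⊕ c ≡ q)

  IsMeet : R → R → R → Set a
  IsMeet m p q = (m ≤ₑ p) × (m ≤ₑ q) × (∀ k → k ≤ₑ p → k ≤ₑ q → k ≤ₑ m)

module Submission where

-- In an effect groupoid the induced order of 𝔼(R) has an
-- equational description:  p ≤ q  iff  p · q′ = 0  (≤ₑ-intro, ≤ₑ-elim).
-- With it, the order is antisymmetric and right multiplication is monotone.
-- For fixed x, y the element  x ⊓ y := (x · y)′ · y  lies below x′ and y
-- (by NG4, after rewriting it with NG6), and every common lower bound k of
-- x′ and y lies below it: k = (k′ · y)′ · y, and applying monotonicity of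
-- (_ · y) twice to  x ≤ k′  gives  k ≤ (x · y)′ · y.  So x ⊓ y is the meet
-- of x′ and y, and by antisymmetry it is the only one.  Finally
-- (x ⊓ y)′ · y = x · y follows from NG5, which says that the operation
-- ℝ(𝔼(R)) rebuilds from the meet and ⊕ is the original product.

open import Defs
open import Level using (Level)
open import Relation.Binary.PropositionalEquality
  using (_≡_; sym; trans; cong; cong₂; subst; module ≡-Reasoning)
open import Data.Product using (_×_; ∃; _,_)

module EffectGroupoidProperties {a : Level} (G : EffectGroupoid a) where
  open EffectGroupoid G
  open EffectAlgebraOf G
  open ≡-Reasoning

  ′-involutive : ∀ x → x ′ ′ ≡ x
  ′-involutive x = sym (NG1 x)

  𝟎′-identityˡ : ∀ c → 𝟎 ′ · c ≡ c
  𝟎′-identityˡ c = trans (cong (_· c) NG3) (·-identityˡ c)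

  -- If u · p = 0 then (u · p)′ · p = p; the terms (u · p)′ · p occur
  -- throughout NG5–NG7, and collapse in this way for orthogonal pairs.
  orthogonal-cancel : ∀ {u p} → u · p ≡ 𝟎 → (u · p) ′ · p ≡ p
  orthogonal-cancel {p = p} h = trans (cong (λ v → v ′ · p) h) (𝟎′-identityˡ p)

  -- Orthogonality is symmetric: p · c = 0 implies c · p = 0.  Indeed
  -- c = (c′ · p′)′ · p′ by NG6 and orthogonality, and then NG4 applies.
  orthogonal-sym : ∀ {p c} → p · c ≡ 𝟎 → c · p ≡ 𝟎
  orthogonal-sym {p} {c} h = begin
      c · p                         ≡⟨ cong (_· p) c-expanded ⟩
      ((c ′ · p ′) ′ · p ′) · p     ≡⟨ NG4ʳ p ((c ′ · p ′) ′) ⟩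
      𝟎                             ∎
    where
    c-expanded : c ≡ (c ′ · p ′) ′ · p ′
    c-expanded = sym (begin
        (c ′ · p ′) ′ · p ′     ≡⟨ NG6b (p ′) c ⟩
        (p ′ ′ · c) ′ · c       ≡⟨ cong (λ u → (u · c) ′ · c) (′-involutive p) ⟩
        (p · c) ′ · c           ≡⟨ orthogonal-cancel h ⟩
        c                       ∎)

  lower-bound-expand : ∀ {k y} → k · y ′ ≡ 𝟎 → k ≡ (k ′ · y) ′ · y
  lower-bound-expand {k} {y} h = begin
      k                   ≡⟨ sym (orthogonal-cancel (orthogonal-sym h)) ⟩
      (y ′ · k) ′ · k     ≡⟨ NG6b k y ⟩
      (k ′ · y) ′ · y     ∎

  ≤ₑ-intro : ∀ {p q} → p · q ′ ≡ 𝟎 → p ≤ₑ q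
  ≤ₑ-intro {p} {q} h = q · p ′ , NG4ˡ p q , sum-is-q
    where
    sum-is-q : (p ′ · (q · p ′) ′) ′ ≡ q
    sum-is-q = begin
        (p ′ · (q · p ′) ′) ′
          ≡⟨ cong (λ u → (p ′ · (u · p ′) ′) ′) (sym (′-involutive q)) ⟩
        (p ′ · (q ′ ′ · p ′) ′) ′
          ≡⟨ cong _′ (trans (NG6a (p ′) (q ′)) (NG6b (p ′) (q ′))) ⟩
        ((p ′ ′ · q ′) ′ · q ′) ′
          ≡⟨ cong (λ u → ((u · q ′) ′ · q ′) ′) (′-involutive p) ⟩
        ((p · q ′) ′ · q ′) ′
          ≡⟨ cong _′ (orthogonal-cancel h) ⟩
        q ′ ′
          ≡⟨ ′-involutive q ⟩
        q ∎

  -- The induced order, necessity: if p ⊕ c = q then p · q′ = 0, because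
  -- q′ = p′ · c′ = c′ · p′ (NG5 with c · p = 0) and NG4 applies.
  ≤ₑ-elim : ∀ {p q} → p ≤ₑ q → p · q ′ ≡ 𝟎
  ≤ₑ-elim {p} {q} (c , p⊥c , p⊕c≡q) = begin
      p · q ′                  ≡⟨ cong (p ·_) q′-as-product ⟩
      p · (p ′ · c ′)          ≡⟨ orthogonal-sym (trans (cong (_· p) swap) (NG4ʳ p (c ′))) ⟩
      𝟎                        ∎
    where
    q′-as-product : q ′ ≡ p ′ · c ′
    q′-as-product = trans (cong _′ (sym p⊕c≡q)) (′-involutive _)
    swap : p ′ · c ′ ≡ c ′ · p ′
    swap = begin
        p ′ · c ′                              ≡⟨ NG5 (p ′) (c ′) ⟩
        c ′ · ((c ′ ′ · p ′ ′) ′ · p ′ ′) ′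
          ≡⟨ cong₂ (λ u v → c ′ · ((u · v) ′ · v) ′) (′-involutive c) (′-involutive p) ⟩
        c ′ · ((c · p) ′ · p) ′
          ≡⟨ cong (λ u → c ′ · u ′) (orthogonal-cancel (orthogonal-sym p⊥c)) ⟩
        c ′ · p ′                              ∎

  ≤-antisym : ∀ {p q} → p · q ′ ≡ 𝟎 → q · p ′ ≡ 𝟎 → p ≡ q
  ≤-antisym {p} {q} p≤q q≤p = begin
      p                  ≡⟨ sym (orthogonal-cancel (orthogonal-sym p≤q)) ⟩
      (q ′ · p) ′ · p    ≡⟨ NG6b p q ⟩
      (p ′ · q) ′ · q    ≡⟨ orthogonal-cancel (orthogonal-sym q≤p) ⟩
      q                  ∎

  -- Right multiplication is monotone: p ≤ q implies p · z ≤ q · z.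
  -- By NG7, q · z = ((s · t′)′ · t′)′ for s = p · z, t = q · z; rewriting
  -- t′ with NG6 exhibits t′ · s as an instance of NG4.
  ·-monoˡ : ∀ {p q} z → p · q ′ ≡ 𝟎 → (p · z) · (q · z) ′ ≡ 𝟎
  ·-monoˡ {p} {q} z p≤q = orthogonal-sym t′s≡𝟎
    where
    s t : R
    s = p · z
    t = q · z
    q′-collapse : (p · q ′) ′ · q ′ ≡ q ′
    q′-collapse = orthogonal-cancel p≤q
    t-by-NG7 : t ≡ ((s · t ′) ′ · t ′) ′
    t-by-NG7 = begin
        q · z                          ≡⟨ cong (_· z) (sym (′-involutive q)) ⟩
        q ′ ′ · z                      ≡⟨ cong (λ u → u ′ · z) (sym q′-collapse) ⟩
        ((p · q ′) ′ · q ′) ′ · z      ≡⟨ NG7 p q z ⟩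
        ((s · t ′) ′ · t ′) ′          ∎
    t′-expanded : t ′ ≡ (t ′ ′ · s ′) ′ · s ′
    t′-expanded = begin
        t ′                      ≡⟨ trans (cong _′ t-by-NG7) (′-involutive _) ⟩
        (s · t ′) ′ · t ′        ≡⟨ cong (λ u → (u · t ′) ′ · t ′) (sym (′-involutive s)) ⟩
        (s ′ ′ · t ′) ′ · t ′    ≡⟨ NG6b (t ′) (s ′) ⟩
        (t ′ ′ · s ′) ′ · s ′    ∎
    t′s≡𝟎 : t ′ · s ≡ 𝟎
    t′s≡𝟎 = trans (cong (_· s) t′-expanded) (NG4ʳ s ((t ′ ′ · s ′) ′))

  -- The meet of x′ and y in the induced order.
  _⊓_ : R → R → R
  x ⊓ y = (x · y) ′ · y

  ⊓-mirror : ∀ x y → x ⊓ y ≡ (y ′ · x ′) ′ · x ′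
  ⊓-mirror x y = sym (trans (NG6b (x ′) y) (cong (λ u → (u · y) ′ · y) (′-involutive x)))

  ⊓-lowerʸ : ∀ x y → (x ⊓ y) · y ′ ≡ 𝟎
  ⊓-lowerʸ x y =
    trans (cong (λ u → ((x · y) ′ · u) · y ′) (sym (′-involutive y))) (NG4ʳ (y ′) ((x · y) ′))

  ⊓-lowerˣ : ∀ x y → (x ⊓ y) · x ′ ′ ≡ 𝟎
  ⊓-lowerˣ x y = trans (cong₂ _·_ (⊓-mirror x y) (′-involutive x)) (NG4ʳ x ((y ′ · x ′) ′))

  -- Every common lower bound k of x′ and y is below x ⊓ y: from x ≤ k′,
  -- monotonicity gives x · y ≤ k′ · y, hence (k′ · y)′ ≤ (x · y)′, and a
  -- second use of monotonicity gives k = (k′ · y)′ · y ≤ x ⊓ y.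
  ⊓-greatest : ∀ x y k → k · x ′ ′ ≡ 𝟎 → k · y ′ ≡ 𝟎 → k · (x ⊓ y) ′ ≡ 𝟎
  ⊓-greatest x y k k≤x′ k≤y =
    subst (λ u → u · (x ⊓ y) ′ ≡ 𝟎) (sym (lower-bound-expand k≤y)) (·-monoˡ y k′y′≤xy′)
    where
    x≤k′ : x · k ′ ′ ≡ 𝟎
    x≤k′ = trans (cong (x ·_) (′-involutive k))
                 (orthogonal-sym (trans (cong (k ·_) (sym (′-involutive x))) k≤x′))
    k′y′≤xy′ : (k ′ · y) ′ · (x · y) ′ ′ ≡ 𝟎
    k′y′≤xy′ = trans (cong ((k ′ · y) ′ ·_) (′-involutive _)) (orthogonal-sym (·-monoˡ y x≤k′))

  ⊓-isMeet : ∀ x y → IsMeet (x ⊓ y) (x ′) y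
  ⊓-isMeet x y =
      ≤ₑ-intro (⊓-lowerˣ x y)
    , ≤ₑ-intro (⊓-lowerʸ x y)
    , λ k k≤x′ k≤y → ≤ₑ-intro (⊓-greatest x y k (≤ₑ-elim k≤x′) (≤ₑ-elim k≤y))

  meet-unique : ∀ x y m → IsMeet m (x ′) y → m ≡ x ⊓ y
  meet-unique x y m (m≤x′ , m≤y , m-greatest) =
    ≤-antisym (⊓-greatest x y m (≤ₑ-elim m≤x′) (≤ₑ-elim m≤y))
              (≤ₑ-elim (m-greatest (x ⊓ y) (≤ₑ-intro (⊓-lowerˣ x y)) (≤ₑ-intro (⊓-lowerʸ x y))))

  -- The product of ℝ(𝔼(R)) written via the meet is the original product:
  -- by NG5 both sides equal y · ((y′ · x′)′ · x′)′.
  meet-product : ∀ x y → ((x ⊓ y) ⊕ (y ′)) ′ ≡ x · y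
  meet-product x y = begin
      ((x ⊓ y) ′ · y ′ ′) ′ ′
        ≡⟨ trans (′-involutive _) (cong ((x ⊓ y) ′ ·_) (′-involutive y)) ⟩
      (x ⊓ y) ′ · y
        ≡⟨ NG5 ((x ⊓ y) ′) y ⟩
      y · ((y ′ · (x ⊓ y) ′ ′) ′ · (x ⊓ y) ′ ′) ′
        ≡⟨ cong (λ u → y · ((y ′ · u) ′ · u) ′) (′-involutive (x ⊓ y)) ⟩
      y · ((y ′ · (x ⊓ y)) ′ · (x ⊓ y)) ′
        ≡⟨ cong (λ u → y · u ′) (orthogonal-cancel (orthogonal-sym (⊓-lowerʸ x y))) ⟩
      y · (x ⊓ y) ′
        ≡⟨ cong (λ u → y · u ′) (⊓-mirror x y) ⟩
      y · ((y ′ · x ′) ′ · x ′) ′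
        ≡⟨ sym (NG5 x y) ⟩
      x · y ∎

mainTheorem4 : ∀ {a : Level} (G : EffectGroupoid a) →
    let open EffectGroupoid G
        open EffectAlgebraOf G
    in ∀ x y →
      (∃ λ m → IsMeet m (x ′) y)
      × (∀ m → IsMeet m (x ′) y →
           (m ⊕-defined (y ′)) × ((m ⊕ (y ′)) ′ ≡ x · y))
mainTheorem4 G x y =
    (x ⊓ y , ⊓-isMeet x y)
  , λ m m-meet →
      let m≡x⊓y = meet-unique x y m m-meet
      in  subst (λ u → u ⊕-defined (y ′)) (sym m≡x⊓y) (⊓-lowerʸ x y)
        , subst (λ u → (u ⊕ (y ′)) ′ ≡ x · y) (sym m≡x⊓y) (meet-product x y)
  where
  open EffectGroupoid G
  open EffectAlgebraOf G
  open EffectGroupoidProperties G
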